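{- Let $G$ be a connected undirected simple graph, let $u$ be a super cut vertex of $G$ and let $v$ be a leaf of $G$ adjacent to $u$. Then the graph $G-v$ obtained by deleting $v$ (and its incident edge) from $G$ has a spanning tree with at least as many internal vertices as a maximum internal spanning tree of $G$ has.
   Context: A leaf of a graph is a vertex of degree $1$; a vertex of a tree is internal if its degree in the tree is at least $2$. A cut vertex of a graph is a vertex whose deletion increases the number of connected components; a cut vertex is super if its deletion increases the number of connected components by at least $2$. A maximum internal spanning tree of a connected graph is a spanning tree with the maximum number of internal vertices. -}

module Defs where

open import Data.Nat using (ℕ; zero; suc; _+_; _≤_; _≤ᵇ_)
open import Data.Fin using (Fin; zero; suc; punchIn; inject₁; fromℕ)
open import Data.Bool using (Bool; true; false; if_then_else_)
open import Data.List using (List; map; allFin)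
open import Data.Nat.ListAction using (sum)
open import Data.Product using (Σ; _×_; ∃)
open import Relation.Binary.PropositionalEquality using (_≡_; _≢_)
open import Relation.Nullary using (¬_)
open import Function.Definitions using (Injective)

record Graph (n : ℕ) : Set where
  field
    adj    : Fin n → Fin n → Bool
    sym    : ∀ x y → adj x y ≡ adj y x
    irrefl : ∀ x → adj x x ≡ false
open Graph public

Adj : ∀ {n} → Graph n → Fin n → Fin n → Set
Adj G x y = adj G x y ≡ true

-- G - v : delete vertex v (and its incident edges); the remaining vertices
-- are re-indexed by Fin n via punchIn v.
delete : ∀ {n} → Graph (suc n) → Fin (suc n) → Graph n
delete G v = record
  { adj    = λ x y → adj G (punchIn v x) (punchIn v y)
  ; sym    = λ x y → sym G (punchIn v x) (punchIn v y)
  ; irrefl = λ x → irrefl G (punchIn v x)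
  }

data Walk {n} (G : Graph n) : Fin n → Fin n → Set where
  here : ∀ {x} → Walk G x x
  step : ∀ {x y z} → Adj G x y → Walk G y z → Walk G x z

Reach : ∀ {n} → Graph n → Fin n → Fin n → Set
Reach G x y = Walk G x y

Connected : ∀ {n} → Graph n → Set
Connected G = ∀ x y → Reach G x y

AtLeastComps : ∀ {n} → Graph n → ℕ → Set
AtLeastComps {n} G m =
  Σ (Fin m → Fin n) λ f → ∀ i j → i ≢ j → ¬ Reach G (f i) (f j)

NumComps : ∀ {n} → Graph n → ℕ → Set
NumComps G c = AtLeastComps G c × ¬ AtLeastComps G (suc c)

CutVertex : ∀ {n} → Graph (suc n) → Fin (suc n) → Set
CutVertex G u = ∀ c → NumComps G c → AtLeastComps (delete G u) (suc c)

SuperCutVertex : ∀ {n} → Graph (suc n) → Fin (suc n) → Set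
SuperCutVertex G u = CutVertex G u × (∀ c → NumComps G c → AtLeastComps (delete G u) (c + 2))

deg : ∀ {n} → Graph n → Fin n → ℕ
deg {n} G x = sum (map (λ y → if adj G x y then 1 else 0) (allFin n))

Leaf : ∀ {n} → Graph n → Fin n → Set
Leaf G v = deg G v ≡ 1

internal : ∀ {n} → Graph n → ℕ
internal {n} T = sum (map (λ x → if 2 ≤ᵇ deg T x then 1 else 0) (allFin n))

record Cycle {n} (G : Graph n) : Set where
  field
    m      : ℕ
    len≥2  : 2 ≤ m
    c      : Fin (suc m) → Fin n
    inj    : Injective _≡_ _≡_ c
    consec : ∀ (i : Fin m) → Adj G (c (inject₁ i)) (c (suc i))
    close  : Adj G (c (fromℕ m)) (c zero)

Acyclic : ∀ {n} → Graph n → Set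
Acyclic G = ¬ Cycle G

Subgraph : ∀ {n} → Graph n → Graph n → Set
Subgraph T G = ∀ x y → Adj T x y → Adj G x y

IsSpanningTree : ∀ {n} → Graph n → Graph n → Set
IsSpanningTree G T = Subgraph T G × Connected T × Acyclic T

IsMIST : ∀ {n} → Graph n → Graph n → Set
IsMIST G T = IsSpanningTree G T × (∀ T' → IsSpanningTree G T' → internal T' ≤ internal T)

-- Delete v from T. Its only T-neighbour is u, so T - v is a spanning tree of G - v, v was not
-- internal in T, and every other vertex keeps its T-degree except u, which loses one. Since u is
-- a super cut vertex of the connected graph G, G - u has at least three components, each of
-- which contains a T-neighbour of u; so deg_T u ≥ 3 and u stays internal.
module Submission where

open import Defs hiding (sym)
open import Data.Bool using (true; false; if_then_else_)
open import Data.Empty using (⊥-elim)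
open import Data.Fin using (Fin; zero; suc; punchIn; punchOut; _≟_)
open import Data.Fin.Properties using (punchIn-injective; punchInᵢ≢i; punchIn-punchOut; punchOut-injective; suc-injective)
open import Data.List using (map; allFin; tabulate)
open import Data.List.Properties using (map-tabulate)
open import Data.Nat using (ℕ; zero; suc; _+_; _≤_; _≤ᵇ_; z≤n; s≤s; s≤s⁻¹)
open import Data.Nat.ListAction using (sum)
open import Data.Nat.Properties
  using (+-0-commutativeMonoid; ≤-refl; ≤-trans; ≤-reflexive; +-mono-≤; n≤0⇒n≡0; module ≤-Reasoning)
open import Algebra.Properties.CommutativeMonoid.Sum +-0-commutativeMonoid
  using (sum-remove; sum-replicate-zero) renaming (sum to ∑)
open import Data.Product using (Σ; _×_; _,_; proj₁; proj₂)
open import Function using (_∘_; id)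
open import Function.Definitions using (Injective)
open import Relation.Binary.PropositionalEquality
  using (_≡_; _≢_; refl; sym; trans; cong; subst; subst₂; module ≡-Reasoning)
open import Relation.Nullary using (¬_; yes; no)

sum-allFin : ∀ {n} (f : Fin n → ℕ) → sum (map f (allFin n)) ≡ ∑ f
sum-allFin f = trans (cong sum (map-tabulate id f)) (sum-tabulate f)
  where
  sum-tabulate : ∀ {m} (g : Fin m → ℕ) → sum (tabulate g) ≡ ∑ g
  sum-tabulate {zero}  g = refl
  sum-tabulate {suc m} g = cong (g zero +_) (sum-tabulate (g ∘ suc))

∑-mono-≤ : ∀ {n} {f g : Fin n → ℕ} → (∀ i → f i ≤ g i) → ∑ f ≤ ∑ g
∑-mono-≤ {zero}  f≤g = z≤n
∑-mono-≤ {suc n} f≤g = +-mono-≤ (f≤g zero) (∑-mono-≤ (f≤g ∘ suc))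

∑-zero : ∀ {n} {f : Fin n → ℕ} → (∀ i → f i ≡ 0) → ∑ f ≡ 0
∑-zero {n} f≡0 = n≤0⇒n≡0 (≤-trans (∑-mono-≤ (≤-reflexive ∘ f≡0)) (≤-reflexive (sum-replicate-zero n)))

∑-≥-injective : ∀ {k n} (f : Fin n → ℕ) (e : Fin k → Fin n) → Injective _≡_ _≡_ e →
                (∀ i → 1 ≤ f (e i)) → k ≤ ∑ f
∑-≥-injective {zero}          f e e-inj pos = z≤n
∑-≥-injective {suc k} {zero}  f e e-inj pos with e zero
... | ()
∑-≥-injective {suc k} {suc n} f e e-inj pos = begin
  1 + k                                 ≤⟨ +-mono-≤ (pos zero) (∑-≥-injective (f ∘ punchIn (e zero)) e′ e′-inj pos′) ⟩
  f (e zero) + ∑ (f ∘ punchIn (e zero)) ≡⟨ sum-remove f ⟨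
  ∑ f                                   ∎
  where
  open ≤-Reasoning
  apart : ∀ i → e zero ≢ e (suc i)
  apart i eq with e-inj eq
  ... | ()
  e′ : Fin k → Fin n
  e′ i = punchOut (apart i)
  e′-inj : Injective _≡_ _≡_ e′
  e′-inj eq = suc-injective (e-inj (punchOut-injective (apart _) (apart _) eq))
  pos′ : ∀ i → 1 ≤ f (punchIn (e zero) (e′ i))
  pos′ i = subst (λ x → 1 ≤ f x) (sym (punchIn-punchOut (apart i))) (pos (suc i))

Adj-sym : ∀ {n} (G : Graph n) {x y} → Adj G x y → Adj G y x
Adj-sym G {x} {y} e = trans (Graph.sym G y x) e

adjacent-distinct : ∀ {n} (G : Graph n) {x y} → Adj G x y → x ≢ y
adjacent-distinct G {x} e refl with trans (sym (irrefl G x)) e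
... | ()

adjacency : ∀ {n} → Graph n → Fin n → Fin n → ℕ
adjacency G x y = if adj G x y then 1 else 0

adjacency-≤1 : ∀ {n} (G : Graph n) x y → adjacency G x y ≤ 1
adjacency-≤1 G x y with adj G x y
... | true  = ≤-refl
... | false = z≤n

deg-∑ : ∀ {n} (G : Graph n) x → deg G x ≡ ∑ (adjacency G x)
deg-∑ G x = sum-allFin (adjacency G x)

deg-≥-injective : ∀ {k n} (G : Graph n) {x} (e : Fin k → Fin n) → Injective _≡_ _≡_ e →
                  (∀ i → Adj G x (e i)) → k ≤ deg G x
deg-≥-injective G {x} e e-inj adjacent =
  subst (_ ≤_) (sym (deg-∑ G x)) (∑-≥-injective (adjacency G x) e e-inj counted)
  where
  counted : ∀ i → 1 ≤ adjacency G x (e i)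
  counted i rewrite adjacent i = ≤-refl

deg-≤1 : ∀ {n} (G : Graph (suc n)) {x} u → (∀ y → Adj G x y → y ≡ u) → deg G x ≤ 1
deg-≤1 G {x} u only-u = begin
  deg G x                                            ≡⟨ deg-∑ G x ⟩
  ∑ (adjacency G x)                                  ≡⟨ sum-remove (adjacency G x) ⟩
  adjacency G x u + ∑ (adjacency G x ∘ punchIn u)    ≡⟨ cong (adjacency G x u +_) (∑-zero elsewhere) ⟩
  adjacency G x u + 0                                ≤⟨ +-mono-≤ (adjacency-≤1 G x u) z≤n ⟩
  1                                                  ∎
  where
  open ≤-Reasoning
  elsewhere : ∀ y → adjacency G x (punchIn u y) ≡ 0
  elsewhere y with adj G x (punchIn u y) in e
  ... | false = refl
  ... | true  = ⊥-elim (punchInᵢ≢i u y (only-u _ e))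

leaf-neighbour : ∀ {n} (G : Graph n) {v u y} → Leaf G v → Adj G v u → Adj G v y → y ≡ u
leaf-neighbour {n} G {v} {u} {y} leaf vu vy with y ≟ u
... | yes y≡u = y≡u
... | no  y≢u = ⊥-elim (two≰one (subst (2 ≤_) leaf (deg-≥-injective G pair pair-injective adjacent)))
  where
  two≰one : ¬ 2 ≤ 1
  two≰one (s≤s ())
  pair : Fin 2 → Fin n
  pair zero    = u
  pair (suc _) = y
  pair-injective : Injective _≡_ _≡_ pair
  pair-injective {zero}     {zero}     _ = refl
  pair-injective {zero}     {suc zero} e = ⊥-elim (y≢u (sym e))
  pair-injective {suc zero} {zero}     e = ⊥-elim (y≢u e)
  pair-injective {suc zero} {suc zero} _ = refl
  adjacent : ∀ i → Adj G v (pair i)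
  adjacent zero    = vu
  adjacent (suc _) = vy

deg-delete : ∀ {n} (T : Graph (suc n)) v x →
             deg T (punchIn v x) ≡ adjacency T (punchIn v x) v + deg (delete T v) x
deg-delete T v x = begin
  deg T (punchIn v x)                          ≡⟨ deg-∑ T (punchIn v x) ⟩
  ∑ adjacency-x                                ≡⟨ sum-remove adjacency-x ⟩
  adjacency-x v + ∑ (adjacency-x ∘ punchIn v)  ≡⟨ cong (adjacency-x v +_) (deg-∑ (delete T v) x) ⟨
  adjacency-x v + deg (delete T v) x           ∎
  where
  open ≡-Reasoning
  adjacency-x : Fin _ → ℕ
  adjacency-x = adjacency T (punchIn v x)

deg-delete-≤ : ∀ {n} (T : Graph (suc n)) v x → deg T (punchIn v x) ≤ suc (deg (delete T v) x)
deg-delete-≤ T v x rewrite deg-delete T v x = +-mono-≤ (adjacency-≤1 T (punchIn v x) v) ≤-refl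

deg-delete-nonadjacent : ∀ {n} (T : Graph (suc n)) v x → adj T (punchIn v x) v ≡ false →
                         deg (delete T v) x ≡ deg T (punchIn v x)
deg-delete-nonadjacent T v x nonadjacent rewrite deg-delete T v x | nonadjacent = refl

isInternal : ℕ → ℕ
isInternal d = if 2 ≤ᵇ d then 1 else 0

isInternal-≤ : ∀ {d d′} → (2 ≤ d → 2 ≤ d′) → isInternal d ≤ isInternal d′
isInternal-≤ {zero}        internal-preserved = z≤n
isInternal-≤ {suc zero}    internal-preserved = z≤n
isInternal-≤ {suc (suc d)} internal-preserved with internal-preserved (s≤s (s≤s z≤n))
... | s≤s (s≤s _) = ≤-refl

isInternal-≤1 : ∀ {d} → d ≤ 1 → isInternal d ≡ 0
isInternal-≤1 z≤n       = refl
isInternal-≤1 (s≤s z≤n) = refl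

internal-∑ : ∀ {n} (T : Graph n) → internal T ≡ ∑ (isInternal ∘ deg T)
internal-∑ T = sum-allFin (isInternal ∘ deg T)

internal-delete : ∀ {n} (T : Graph (suc n)) v → deg T v ≤ 1 →
                  (∀ x → 2 ≤ deg T (punchIn v x) → 2 ≤ deg (delete T v) x) →
                  internal T ≤ internal (delete T v)
internal-delete T v leaf stays-internal = begin
  internal T                                                    ≡⟨ internal-∑ T ⟩
  ∑ (isInternal ∘ deg T)                                        ≡⟨ sum-remove (isInternal ∘ deg T) ⟩
  isInternal (deg T v) + ∑ (isInternal ∘ deg T ∘ punchIn v)     ≡⟨ cong (_+ ∑ (isInternal ∘ deg T ∘ punchIn v)) (isInternal-≤1 leaf) ⟩
  ∑ (isInternal ∘ deg T ∘ punchIn v)                            ≤⟨ ∑-mono-≤ (λ x → isInternal-≤ (stays-internal x)) ⟩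
  ∑ (isInternal ∘ deg (delete T v))                             ≡⟨ internal-∑ (delete T v) ⟨
  internal (delete T v)                                         ∎
  where open ≤-Reasoning

_++ʷ_ : ∀ {n} {G : Graph n} {x y z} → Walk G x y → Walk G y z → Walk G x z
here     ++ʷ W′ = W′
step e W ++ʷ W′ = step e (W ++ʷ W′)

reverseʷ : ∀ {n} {G : Graph n} {x y} → Walk G x y → Walk G y x
reverseʷ         here       = here
reverseʷ {G = G} (step e W) = reverseʷ W ++ʷ step (Adj-sym G e) here

delete-subgraph : ∀ {n} (T G : Graph (suc n)) v → Subgraph T G → Subgraph (delete T v) (delete G v)
delete-subgraph T G v T⊆G x y = T⊆G (punchIn v x) (punchIn v y)

delete-acyclic : ∀ {n} {T : Graph (suc n)} v → Acyclic T → Acyclic (delete T v)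
delete-acyclic v acyclic C = acyclic record
  { m      = Cycle.m C
  ; len≥2  = Cycle.len≥2 C
  ; c      = punchIn v ∘ Cycle.c C
  ; inj    = Cycle.inj C ∘ punchIn-injective v _ _
  ; consec = Cycle.consec C
  ; close  = Cycle.close C
  }

-- A walk may pass through the pendant vertex v only as u → v → u, so that detour can be cut out.
delete-pendant-connected : ∀ {n} (T : Graph (suc n)) v u → (∀ y → Adj T v y → y ≡ punchIn v u) →
                           Connected T → Connected (delete T v)
delete-pendant-connected T v u pendant connected x y =
  shortcut (connected (punchIn v x) (punchIn v y)) refl refl
  where
  shortcut : ∀ {a b x y} → Walk T a b → punchIn v x ≡ a → punchIn v y ≡ b → Walk (delete T v) x y
  shortcut {x = x} {y} here ex ey = subst (Walk _ x) (punchIn-injective v x y (trans ex (sym ey))) here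
  shortcut (step {y = c} e W) ex ey with c ≟ v
  shortcut (step e here) ex ey | yes refl = ⊥-elim (punchInᵢ≢i v _ ey)
  shortcut {x = x} (step e (step e′ W)) ex ey | yes refl =
    subst (λ x′ → Walk _ x′ _) (sym x≡u) (shortcut W (sym (pendant _ e′)) ey)
    where
    x≡u : x ≡ u
    x≡u = punchIn-injective v x u (trans ex (pendant _ (Adj-sym T e)))
  shortcut (step {y = c} e W) ex ey | no c≢v = step (subst₂ (Adj T) (sym ex) (sym c≡c′) e) (shortcut W c≡c′ ey)
    where
    c≡c′ : punchIn v (punchOut (c≢v ∘ sym)) ≡ c
    c≡c′ = punchIn-punchOut (c≢v ∘ sym)

delete-pendant-internal : ∀ {n} (T : Graph (suc n)) v u → (∀ y → Adj T v y → y ≡ punchIn v u) →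
                          3 ≤ deg T (punchIn v u) →
                          ∀ x → 2 ≤ deg T (punchIn v x) → 2 ≤ deg (delete T v) x
delete-pendant-internal T v u pendant u-branching x x-internal with x ≟ u
... | yes refl = s≤s⁻¹ (≤-trans u-branching (deg-delete-≤ T v u))
... | no  x≢u  = subst (2 ≤_) (sym (deg-delete-nonadjacent T v x nonadjacent)) x-internal
  where
  nonadjacent : adj T (punchIn v x) v ≡ false
  nonadjacent with adj T (punchIn v x) v in e
  ... | false = refl
  ... | true  = ⊥-elim (x≢u (punchIn-injective v x u (pendant _ (Adj-sym T e))))

connected⇒one-component : ∀ {n} (G : Graph (suc n)) → Connected G → NumComps G 1
connected⇒one-component G connected =
  ((λ _ → zero) , λ { zero zero 0≢0 _ → 0≢0 refl }) ,
  λ (_ , separated) → separated zero (suc zero) (λ ()) (connected _ _)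

-- Stopping a T-walk from x at its first visit to u: the previous vertex is a T-neighbour of u,
-- and the walk up to it avoids u, hence lies in G - u.
walk-to-neighbour : ∀ {n} (G : Graph (suc n)) {T u a} → Subgraph T G → Walk T a u →
                    ∀ {x} → punchIn u x ≡ a → Σ (Fin n) λ b → Adj T u (punchIn u b) × Walk (delete G u) x b
walk-to-neighbour G                 T⊆G here               ex = ⊥-elim (punchInᵢ≢i _ _ ex)
walk-to-neighbour G {T = T} {u = u} T⊆G (step {y = c} e W) {x} ex with c ≟ u
... | yes refl = x , Adj-sym T (subst (λ a → Adj T a u) (sym ex) e) , here
... | no  c≢u  with walk-to-neighbour G T⊆G W (punchIn-punchOut (c≢u ∘ sym))
...   | b , ub , W′ = b , ub , step (T⊆G _ _ (subst₂ (Adj T) (sym ex) (sym c≡c′) e)) W′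
  where
  c≡c′ : punchIn u (punchOut (c≢u ∘ sym)) ≡ c
  c≡c′ = punchIn-punchOut (c≢u ∘ sym)

-- Vertices in different components of G - u reach different T-neighbours of u.
components-≤-deg : ∀ {n k} (G : Graph (suc n)) {T} u → Subgraph T G → Connected T →
                   AtLeastComps (delete G u) k → k ≤ deg T u
components-≤-deg {n} {k} G {T} u T⊆G connected (w , separated) =
  deg-≥-injective T neighbour neighbour-injective (proj₁ ∘ proj₂ ∘ route)
  where
  route : ∀ i → Σ (Fin n) λ b → Adj T u (punchIn u b) × Walk (delete G u) (w i) b
  route i = walk-to-neighbour G T⊆G (connected (punchIn u (w i)) u) refl
  neighbour : Fin k → Fin (suc n)
  neighbour = punchIn u ∘ proj₁ ∘ route
  neighbour-injective : Injective _≡_ _≡_ neighbour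
  neighbour-injective {i} {j} same with i ≟ j
  ... | yes i≡j = i≡j
  ... | no  i≢j = ⊥-elim (separated i j i≢j (proj₂ (proj₂ (route i)) ++ʷ
                    subst (λ b → Walk (delete G u) b (w j)) (punchIn-injective u _ _ (sym same))
                      (reverseʷ (proj₂ (proj₂ (route j))))))

super-cut-deg : ∀ {n} (G T : Graph (suc n)) u → Connected G → SuperCutVertex G u →
                IsSpanningTree G T → 3 ≤ deg T u
super-cut-deg G T u connected (_ , super) (T⊆G , T-connected , _) =
  components-≤-deg G u T⊆G T-connected (super 1 (connected⇒one-component G connected))

lemma4 : ∀ {n} (G : Graph (suc n)) (u v : Fin (suc n))
         → Connected G → SuperCutVertex G u → Leaf G v → Adj G u v
         → (T : Graph (suc n)) → IsMIST G T
         → Σ (Graph n) λ T' → IsSpanningTree (delete G v) T' × internal T ≤ internal T'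
lemma4 {n} G u v connected super leaf uv T (spanning@(T⊆G , T-connected , T-acyclic) , _) =
  delete T v ,
  (delete-subgraph T G v T⊆G , delete-pendant-connected T v u′ pendant T-connected , delete-acyclic v T-acyclic) ,
  internal-delete T v (deg-≤1 T u only-u)
    (delete-pendant-internal T v u′ pendant (subst (λ w → 3 ≤ deg T w) (sym u′↦u) u-branching))
  where
  v≢u : v ≢ u
  v≢u = adjacent-distinct G uv ∘ sym
  u′ : Fin n
  u′ = punchOut v≢u
  u′↦u : punchIn v u′ ≡ u
  u′↦u = punchIn-punchOut v≢u
  only-u : ∀ y → Adj T v y → y ≡ u
  only-u y vy = leaf-neighbour G leaf (Adj-sym G uv) (T⊆G v y vy)
  pendant : ∀ y → Adj T v y → y ≡ punchIn v u′
  pendant y vy = trans (only-u y vy) (sym u′↦u)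
  u-branching : 3 ≤ deg T u
  u-branching = super-cut-deg G T u connected super spanning
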